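{- Let $\mathcal{G}$ be a finite simple graph with vertex set $\mathcal{V}$, let $\mathcal{A}\subseteq\mathcal{V}$ and let $\eta$ be an automorphism of $\mathcal{G}$. Then $\mathcal{K}\in\mathcal{RED}_{\mathcal{A}}(\mathcal{G})$ if and only if $\eta(\mathcal{K})\in\mathcal{RED}_{\eta(\mathcal{A})}(\mathcal{G})$.
   Context: For $\mathcal{A}\subseteq\mathcal{V}$, $x\equiv_{\mathcal{A}}y$ iff $\mathcal{O}(x)\cap\mathcal{A}=\mathcal{O}(y)\cap\mathcal{A}$, where $\mathcal{O}(x)$ is the orbit of $x$ under $\mathrm{Aut}(\mathcal{G})$; $\gamma_{\mathcal{A}}(\mathcal{G})$ is the partition of $\mathcal{V}$ into the equivalence classes of $\equiv_{\mathcal{A}}$. $\mathcal{RED}_{\mathcal{A}}(\mathcal{G})$ is the set of reducts of $\mathcal{A}$, i.e. of subsets $\mathcal{K}\subseteq\mathcal{A}$ with $\gamma_{\mathcal{K}}(\mathcal{G})=\gamma_{\mathcal{A}}(\mathcal{G})$ that are minimal with respect to inclusion with this property. -}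

module Defs where

open import Data.Nat using (ℕ)
open import Data.Fin using (Fin)
open import Data.Fin.Subset using (Subset; _∈_; _⊆_)
open import Data.Fin.Permutation using (Permutation′; _⟨$⟩ʳ_; _⟨$⟩ˡ_)
open import Data.Vec using (tabulate; lookup)
open import Data.Product using (Σ; _×_; proj₁)
open import Function.Bundles using (_⇔_)
open import Relation.Binary.PropositionalEquality using (_≡_)
open import Relation.Nullary using (¬_)

record SimpleGraph (n : ℕ) : Set₁ where
  field
    Adj     : Fin n → Fin n → Set
    symm    : ∀ {x y} → Adj x y → Adj y x
    irrefl  : ∀ {x} → ¬ Adj x x

open SimpleGraph public

IsAutomorphism : ∀ {n} → SimpleGraph n → Permutation′ n → Set
IsAutomorphism G η = ∀ x y → Adj G x y ⇔ Adj G (η ⟨$⟩ʳ x) (η ⟨$⟩ʳ y)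

Aut : ∀ {n} → SimpleGraph n → Set
Aut {n} G = Σ (Permutation′ n) (IsAutomorphism G)

InOrbit : ∀ {n} → SimpleGraph n → Fin n → Fin n → Set
InOrbit G x z = Σ (Aut G) λ σ → proj₁ σ ⟨$⟩ʳ x ≡ z

EquivA : ∀ {n} → SimpleGraph n → Subset n → Fin n → Fin n → Set
EquivA G A x y = ∀ z → z ∈ A → (InOrbit G x z ⇔ InOrbit G y z)

-- γ_K(G) = γ_A(G): the partitions into equivalence classes coincide,
-- i.e. the two equivalence relations coincide.
SamePartition : ∀ {n} → SimpleGraph n → Subset n → Subset n → Set
SamePartition G K A = ∀ x y → EquivA G K x y ⇔ EquivA G A x y

IsReduct : ∀ {n} → SimpleGraph n → Subset n → Subset n → Set
IsReduct G A K =
  (K ⊆ A) × SamePartition G K A ×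
  (∀ K′ → K′ ⊆ K → SamePartition G K′ A → K′ ≡ K)

image : ∀ {n} → Permutation′ n → Subset n → Subset n
image η S = tabulate λ y → lookup S (η ⟨$⟩ˡ y)

{-# OPTIONS --safe #-}
-- Since z and η(z) lie in the same orbit, O(x) contains z iff it contains
-- η(z); hence O(x) ∩ S and O(y) ∩ S agree iff O(x) ∩ η(S) and O(y) ∩ η(S)
-- do, i.e. ≡_S and ≡_η(S) are the same relation. So η maps the K ⊆ A with
-- γ_K = γ_A onto the K′ ⊆ η(A) with γ_K′ = γ_η(A), and being an
-- inclusion-preserving bijection on subsets it preserves minimality.
-- The converse is the same argument for η⁻¹.
module Submission where

open import Defs
open import Level using (0ℓ)
open import Data.Nat using (ℕ)
open import Data.Fin.Subset using (Subset; _∈_; _⊆_)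
open import Data.Fin.Permutation using (Permutation′; _⟨$⟩ʳ_; _⟨$⟩ˡ_; flip; _∘ₚ_; inverseˡ; inverseʳ)
open import Data.Vec using (tabulate; lookup)
open import Data.Vec.Properties using ([]=⇒lookup; lookup⇒[]=; lookup∘tabulate; tabulate∘lookup; tabulate-cong)
open import Data.Product using (_,_)
open import Function using (_∘_)
open import Function.Bundles using (_⇔_; mk⇔; Equivalence)
open import Function.Properties.Equivalence using (⇔-isEquivalence)
open import Relation.Binary.Structures using (IsEquivalence)
open import Relation.Binary.PropositionalEquality
  using (_≡_; refl; sym; trans; cong; subst; subst₂; module ≡-Reasoning)

open Equivalence using (to; from)
open IsEquivalence (⇔-isEquivalence {ℓ = 0ℓ}) using () renaming (sym to ⇔-sym; trans to ⇔-trans)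

module _ {n : ℕ} (G : SimpleGraph n) where

  isAutomorphism-flip : ∀ η → IsAutomorphism G η → IsAutomorphism G (flip η)
  isAutomorphism-flip η aut x y =
    ⇔-sym (subst₂ (λ u v → Adj G (η ⟨$⟩ˡ x) (η ⟨$⟩ˡ y) ⇔ Adj G u v) (inverseʳ η) (inverseʳ η)
                  (aut (η ⟨$⟩ˡ x) (η ⟨$⟩ˡ y)))

  isAutomorphism-∘ : ∀ σ τ → IsAutomorphism G σ → IsAutomorphism G τ →
                     IsAutomorphism G (σ ∘ₚ τ)
  isAutomorphism-∘ σ τ autσ autτ x y = ⇔-trans (autσ x y) (autτ (σ ⟨$⟩ʳ x) (σ ⟨$⟩ʳ y))

  inOrbit-sym : ∀ {x z} → InOrbit G x z → InOrbit G z x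
  inOrbit-sym ((σ , aut) , σx≡z) =
    (flip σ , isAutomorphism-flip σ aut) , trans (cong (σ ⟨$⟩ˡ_) (sym σx≡z)) (inverseˡ σ)

  inOrbit-trans : ∀ {x y z} → InOrbit G x y → InOrbit G y z → InOrbit G x z
  inOrbit-trans ((σ , autσ) , σx≡y) ((τ , autτ) , τy≡z) =
    (σ ∘ₚ τ , isAutomorphism-∘ σ τ autσ autτ) , trans (cong (τ ⟨$⟩ʳ_) σx≡y) τy≡z

  inOrbit-resp : ∀ {x z w} → InOrbit G z w → InOrbit G x z ⇔ InOrbit G x w
  inOrbit-resp z~w = mk⇔ (λ x~z → inOrbit-trans x~z z~w) (λ x~w → inOrbit-trans x~w (inOrbit-sym z~w))

lookup-image : ∀ {n} η (S : Subset n) y → lookup (image η S) y ≡ lookup S (η ⟨$⟩ˡ y)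
lookup-image η S = lookup∘tabulate (lookup S ∘ (η ⟨$⟩ˡ_))

∈-image⁻ : ∀ {n} η (S : Subset n) {y} → y ∈ image η S → η ⟨$⟩ˡ y ∈ S
∈-image⁻ η S {y} y∈ηS = lookup⇒[]= _ S (trans (sym (lookup-image η S y)) ([]=⇒lookup y∈ηS))

∈-image⁺ : ∀ {n} η (S : Subset n) {y} → η ⟨$⟩ˡ y ∈ S → y ∈ image η S
∈-image⁺ η S {y} η⁻¹y∈S = lookup⇒[]= _ _ (trans (lookup-image η S y) ([]=⇒lookup η⁻¹y∈S))

∈-image : ∀ {n} η (S : Subset n) {x} → x ∈ S → η ⟨$⟩ʳ x ∈ image η S
∈-image η S x∈S = ∈-image⁺ η S (subst (_∈ S) (sym (inverseˡ η)) x∈S)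

image-mono : ∀ {n} η {S T : Subset n} → S ⊆ T → image η S ⊆ image η T
image-mono η {S} {T} S⊆T = ∈-image⁺ η T ∘ S⊆T ∘ ∈-image⁻ η S

image-flip-image : ∀ {n} η (S : Subset n) → image (flip η) (image η S) ≡ S
image-flip-image η S = begin
  image (flip η) (image η S) ≡⟨ tabulate-cong (λ y → trans (lookup-image η S (η ⟨$⟩ʳ y))
                                                            (cong (lookup S) (inverseˡ η))) ⟩
  tabulate (lookup S)        ≡⟨ tabulate∘lookup S ⟩
  S                          ∎
  where open ≡-Reasoning

image-image-flip : ∀ {n} η (S : Subset n) → image η (image (flip η) S) ≡ S
image-image-flip η = image-flip-image (flip η)

module _ {n : ℕ} (G : SimpleGraph n) (η : Permutation′ n) (aut : IsAutomorphism G η) where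

  equivA-image : ∀ S x y → EquivA G (image η S) x y ⇔ EquivA G S x y
  equivA-image S x y = mk⇔
    (λ x≡y z z∈S →
      let z~ηz : InOrbit G z (η ⟨$⟩ʳ z)
          z~ηz = (η , aut) , refl
      in move-along z~ηz (x≡y (η ⟨$⟩ʳ z) (∈-image η S z∈S)))
    (λ x≡y z z∈ηS →
      let z~η⁻¹z : InOrbit G z (η ⟨$⟩ˡ z)
          z~η⁻¹z = (flip η , isAutomorphism-flip G η aut) , refl
      in move-along z~η⁻¹z (x≡y (η ⟨$⟩ˡ z) (∈-image⁻ η S z∈ηS)))
    where
    move-along : ∀ {z w} → InOrbit G z w → InOrbit G x w ⇔ InOrbit G y w → InOrbit G x z ⇔ InOrbit G y z
    move-along z~w x⇔y = ⇔-trans (inOrbit-resp G z~w) (⇔-trans x⇔y (⇔-sym (inOrbit-resp G z~w)))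

  samePartition-image : ∀ K A → SamePartition G (image η K) (image η A) ⇔ SamePartition G K A
  samePartition-image K A = mk⇔
    (λ sp x y → ⇔-trans (⇔-sym (equivA-image K x y)) (⇔-trans (sp x y) (equivA-image A x y)))
    (λ sp x y → ⇔-trans (equivA-image K x y) (⇔-trans (sp x y) (⇔-sym (equivA-image A x y))))

  isReduct-image : ∀ A K → IsReduct G A K → IsReduct G (image η A) (image η K)
  isReduct-image A K (K⊆A , sp , minimal) =
    image-mono η K⊆A , from (samePartition-image K A) sp , minimal′
    where
    minimal′ : ∀ K′ → K′ ⊆ image η K → SamePartition G K′ (image η A) → K′ ≡ image η K
    minimal′ K′ K′⊆ηK sp′ = begin
      K′                          ≡⟨ sym (image-image-flip η K′) ⟩
      image η (image (flip η) K′) ≡⟨ cong (image η) (minimal _ η⁻¹K′⊆K η⁻¹K′≈A) ⟩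
      image η K                   ∎
      where
      open ≡-Reasoning
      η⁻¹K′⊆K : image (flip η) K′ ⊆ K
      η⁻¹K′⊆K = subst (image (flip η) K′ ⊆_) (image-flip-image η K) (image-mono (flip η) K′⊆ηK)
      η⁻¹K′≈A : SamePartition G (image (flip η) K′) A
      η⁻¹K′≈A = to (samePartition-image (image (flip η) K′) A)
                   (subst (λ S → SamePartition G S (image η A)) (sym (image-image-flip η K′)) sp′)

proposition1p0p9 : ∀ {n} (G : SimpleGraph n) (A K : Subset n) (η : Permutation′ n) →
    IsAutomorphism G η →
    (IsReduct G A K ⇔ IsReduct G (image η A) (image η K))
proposition1p0p9 G A K η aut = mk⇔
  (isReduct-image G η aut A K)
  (subst₂ (IsReduct G) (image-flip-image η A) (image-flip-image η K)
    ∘ isReduct-image G (flip η) (isAutomorphism-flip G η aut) (image η A) (image η K))
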